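{- For any SLH formula $\forall h . \phi$, if there is a counterexample interpretation $\Gamma$ with $\Gamma \models \neg \phi$, then there is an interpretation $\Gamma'$ with $\Gamma' \models \neg \phi$ in which every heap-sorted variable is interpreted by a homeomorphism kernel.
   Context: SLH is the theory of singly-linked lists with length over a background arithmetic theory $\mathcal{T_B}$. Its formulae are boolean combinations of $\mathcal{T_B}$-literals and heap functions $\mathit{alias}(h,x,y)$, $\mathit{isPath}(h,x,y)$, $\mathit{pathLength}(h,x,y)$, $\mathit{isNull}(h,x)$, $\mathit{circular}(h,x)$ and heap transformers $h'=\mathit{new}(h,x)$, $h'=\mathit{assign}(h,x,y)$, $h'=\mathit{lookup}(h,x,y)$, $h'=\mathit{update}(h,x,y)$. Here $h,h'$ are heap variables, $x,y$ range over a finite set $P$ of pointer variables (including $\mathbf{null}$), and an interpretation $\Gamma$ maps free variables to elements of the appropriate sort. A heap is a pair $H=\langle L,G\rangle$ with $G$ a finite graph whose edges carry weights in $\mathbb{N}$ (default weight 1) and $L:P\to V(G)$ a labelling. $H$ is a singly linked heap if every vertex has outdegree 1 except a single sink of outdegree 0 labelled by $\mathbf{null}$. $\mathit{pathLength}(H,x,y)$ is the minimal total weight of a path from $L(x)$ to $L(y)$ (or $\infty$ if there is none), and $\mathit{circular}(H,x)$ holds iff there is a non-empty path from $L(x)$ back to $L(x)$. An edge subdivision replaces an edge $(u,v)$ by $(u,q),(q,v)$ with a fresh vertex $q$ and weights summing to $w(u,v)$. Smoothing is the inverse operation, removing an unlabelled vertex with a single incoming edge. Two heaps are homeomorphic ($H\sim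 H'$) iff some subdivision of $H$ is isomorphic, via a graph isomorphism on the parts reachable from $P$ that respects the labelling, to some subdivision of $H'$. The kernel $\mathrm{Ke}(H)$ is the maximally smoothed heap in the homeomorphism class of $H$. It is proved that homeomorphism is sound: homeomorphic heaps agree on all $\mathit{pathLength}$ and $\mathit{circular}$ observations, and each transformer maps homeomorphic heaps to homeomorphic heaps. It is also proved that kernels are small: $\|\mathrm{Ke}(H)\|\le 2\times\|P\|$ vertices. -}

module Defs where

open import Level using (0ℓ)
open import Data.Nat using (ℕ; zero; suc; _+_; _≤_; s≤s; z≤n)
open import Data.Fin using (Fin; zero; suc; _≟_)
open import Data.Maybe using (Maybe; just; nothing)
import Data.Maybe as Maybe
open import Data.Product using (Σ; Σ-syntax; ∃; _×_; _,_; proj₁; proj₂; map₁)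
open import Data.Sum using (_⊎_; inj₁; inj₂)
open import Data.Empty using (⊥; ⊥-elim)
open import Data.Unit using (⊤; tt)
open import Relation.Nullary using (¬_; yes; no)
open import Relation.Binary.PropositionalEquality using (_≡_; _≢_; refl; sym; trans; cong)
open import Relation.Binary.Construct.Closure.ReflexiveTransitive using (Star)

data ℕ∞ : Set where
  fin : ℕ → ℕ∞
  ∞   : ℕ∞

data Ptr (np : ℕ) : Set where
  null : Ptr np
  var  : Fin np → Ptr np

-- Vertices are Fin V; each vertex has at most one outgoing weighted edge
-- (next v = just (u , w) : edge v → u of weight w), the unique vertex of
-- outdegree 0 is the one labelled by null.  Edge weights are positive
-- naturals (default 1; subdivision splits a weight into positive parts).

record Heap (np : ℕ) : Set where
  field
    V          : ℕ
    next       : Fin V → Maybe (Fin V × ℕ)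
    L          : Ptr np → Fin V
    weight-pos : ∀ v u w → next v ≡ just (u , w) → 1 ≤ w
    sink-null  : ∀ v → next v ≡ nothing → v ≡ L null
    null-sink  : next (L null) ≡ nothing
open Heap public

data Walk {np : ℕ} (H : Heap np) : Fin (V H) → Fin (V H) → ℕ → Set where
  []  : ∀ {u} → Walk H u u 0
  _∷_ : ∀ {u v x w k} → next H u ≡ just (v , w) → Walk H v x k → Walk H u x (w + k)

PathLen : ∀ {np} (H : Heap np) → Fin (V H) → Fin (V H) → ℕ∞ → Set
PathLen H u v (fin k) = Walk H u v k × (∀ k' → Walk H u v k' → k ≤ k')
PathLen H u v ∞       = ¬ (Σ ℕ λ k → Walk H u v k)

HasPath : ∀ {np} (H : Heap np) → Fin (V H) → Fin (V H) → Set
HasPath H u v = Σ ℕ λ k → Walk H u v k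

Cyclic : ∀ {np} (H : Heap np) → Fin (V H) → Set
Cyclic H u = Σ (Fin (V H)) λ v → Σ ℕ λ w → Σ ℕ λ k →
  next H u ≡ just (v , w) × Walk H v u k

Reach : ∀ {np} (H : Heap np) → Fin (V H) → Set
Reach H v = Σ (Ptr _) λ p → HasPath H (L H p) v

record Subdiv1 {np : ℕ} (H H' : Heap np) : Set where
  field
    ι      : Fin (V H) → Fin (V H')
    ι-inj  : ∀ a b → ι a ≡ ι b → a ≡ b
    q      : Fin (V H')
    fresh  : ∀ a → ι a ≢ q
    cover  : ∀ b → b ≡ q ⊎ Σ (Fin (V H)) λ a → ι a ≡ b
    u v    : Fin (V H)
    w₁ w₂  : ℕ
    edge   : next H u ≡ just (v , w₁ + w₂)
    edge-u : next H' (ι u) ≡ just (q , w₁)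
    edge-q : next H' q ≡ just (ι v , w₂)
    other  : ∀ x → x ≢ u → next H' (ι x) ≡ Maybe.map (map₁ ι) (next H x)
    lab    : ∀ p → L H' p ≡ ι (L H p)

Subdivision : ∀ {np} → Heap np → Heap np → Set
Subdivision = Star Subdiv1

record ReachIso {np : ℕ} (H H' : Heap np) : Set where
  field
    f      : Fin (V H) → Fin (V H')
    g      : Fin (V H') → Fin (V H)
    f-reach : ∀ a → Reach H a → Reach H' (f a)
    g-reach : ∀ b → Reach H' b → Reach H (g b)
    gf     : ∀ a → Reach H a → g (f a) ≡ a
    fg     : ∀ b → Reach H' b → f (g b) ≡ b
    lab    : ∀ p → f (L H p) ≡ L H' p
    edges  : ∀ a → Reach H a → next H' (f a) ≡ Maybe.map (map₁ f) (next H a)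

Homeo : ∀ {np} → Heap np → Heap np → Set
Homeo H H' = Σ (Heap _) λ S → Σ (Heap _) λ S' →
  Subdivision H S × Subdivision H' S' × ReachIso S S'

Unlabelled : ∀ {np} (H : Heap np) → Fin (V H) → Set
Unlabelled H q = ∀ p → L H p ≢ q

SingleIncoming : ∀ {np} (H : Heap np) → Fin (V H) → Set
SingleIncoming H q = Σ (Fin (V H)) λ u → Σ ℕ λ w →
  next H u ≡ just (q , w) × (∀ u' w' → next H u' ≡ just (q , w') → u' ≡ u)

Smoothable : ∀ {np} (H : Heap np) → Fin (V H) → Set
Smoothable H q = Unlabelled H q × SingleIncoming H q

IsKernel : ∀ {np} → Heap np → Set
IsKernel H = (∀ v → Reach H v) × (∀ q → ¬ Smoothable H q)

-- Heap transformers (as relations: T H H'' means H'' is a result)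

relabel : ∀ {np} (H : Heap np) → Fin np → Fin (V H) → Heap np
relabel {np} H x t = record
  { V = V H ; next = next H ; L = L' ; weight-pos = weight-pos H
  ; sink-null = sink-null H ; null-sink = null-sink H }
  where
  L' : Ptr np → Fin (V H)
  L' null = L H null
  L' (var y) with x ≟ y
  ... | yes _ = t
  ... | no  _ = L H (var y)

Assign : ∀ {np} → Heap np → Fin np → Ptr np → Heap np → Set
Assign H x y H'' = H'' ≡ relabel H x (L H y)

-- lookup(h,x,y) : x := y.next  (undefined, i.e. no result, if y is null).
-- If the outgoing edge of y has weight 1, x points to its target;
-- otherwise the edge is subdivided with a first part of weight 1 and
-- x points to the new vertex.
Lookup : ∀ {np} → Heap np → Fin np → Ptr np → Heap np → Set
Lookup H x y H'' =
  (Σ (Fin (V H)) λ t → next H (L H y) ≡ just (t , 1) × H'' ≡ relabel H x t)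
  ⊎ (Σ (Heap _) λ S → Σ (Subdiv1 H S) λ s →
       Subdiv1.u s ≡ L H y × Subdiv1.w₁ s ≡ 1 × H'' ≡ relabel S x (Subdiv1.q s))

-- new(h,x) : x := new cell, whose next field is null (edge of weight 1)
newNextF : ∀ {n} → Fin n → (Fin n → Maybe (Fin n × ℕ)) → Fin (suc n) → Maybe (Fin (suc n) × ℕ)
newNextF nl nx zero    = just (suc nl , 1)
newNextF nl nx (suc a) = Maybe.map (map₁ suc) (nx a)

newHeap : ∀ {np} (H : Heap np) → Fin np → Heap np
newHeap {np} H x = record
  { V = suc (V H) ; next = nx ; L = L' ; weight-pos = wp
  ; sink-null = sn ; null-sink = ns }
  where
  nx : Fin (suc (V H)) → Maybe (Fin (suc (V H)) × ℕ)
  nx = newNextF (L H null) (next H)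
  L' : Ptr np → Fin (suc (V H))
  L' null = suc (L H null)
  L' (var y) with x ≟ y
  ... | yes _ = zero
  ... | no  _ = suc (L H (var y))
  wp : ∀ v u w → nx v ≡ just (u , w) → 1 ≤ w
  wp zero u w refl = s≤s z≤n
  wp (suc a) u w e with next H a in eq
  wp (suc a) u w refl | just (b , w') = weight-pos H a b w' eq
  sn : ∀ v → nx v ≡ nothing → v ≡ L' null
  sn zero ()
  sn (suc a) e with next H a in eq
  sn (suc a) e  | nothing = cong suc (sink-null H a eq)
  sn (suc a) () | just _
  ns : nx (L' null) ≡ nothing
  ns with next H (L H null) | null-sink H
  ... | nothing | refl = refl

New : ∀ {np} → Heap np → Fin np → Heap np → Set
New H x H'' = H'' ≡ newHeap H x

-- update(h,x,y) : x.next := y (edge of weight 1); undefined (no result)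
-- if x is null or aliases null
updateHeap : ∀ {np} (H : Heap np) (x : Fin np) → Ptr np → L H (var x) ≢ L H null → Heap np
updateHeap {np} H x y ne = record
  { V = V H ; next = nx ; L = L H ; weight-pos = wp
  ; sink-null = sn ; null-sink = ns }
  where
  nx : Fin (V H) → Maybe (Fin (V H) × ℕ)
  nx v with v ≟ L H (var x)
  ... | yes _ = just (L H y , 1)
  ... | no  _ = next H v
  wp : ∀ v u w → nx v ≡ just (u , w) → 1 ≤ w
  wp v u w e with v ≟ L H (var x)
  wp v u w refl | yes _ = s≤s z≤n
  ... | no _ = weight-pos H v u w e
  sn : ∀ v → nx v ≡ nothing → v ≡ L H null
  sn v e with v ≟ L H (var x)
  sn v () | yes _
  ... | no _ = sink-null H v e
  ns : nx (L H null) ≡ nothing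
  ns with L H null ≟ L H (var x)
  ... | yes p = ⊥-elim (ne (sym p))
  ... | no _ = null-sink H

Update : ∀ {np} → Heap np → Fin np → Ptr np → Heap np → Set
Update H x y H'' = Σ (L H (var x) ≢ L H null) λ ne → H'' ≡ updateHeap H x y ne

-- The background theory T_B is taken in full generality
-- over an arbitrary domain D: terms are data variables, constants,
-- arbitrary (binary) function symbols and pathLength(h,x,y), whose
-- ℕ∪{∞} value is injected into D by emb; atoms are arbitrary binary
-- predicates on D.

data Term (D : Set) (np nh nd : ℕ) : Set where
  dvar       : Fin nd → Term D np nh nd
  const      : D → Term D np nh nd
  app        : (D → D → D) → Term D np nh nd → Term D np nh nd → Term D np nh nd
  pathLength : Fin nh → Ptr np → Ptr np → Term D np nh nd

data Formula (D : Set) (np nh nd : ℕ) : Set₁ where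
  rel      : (D → D → Set) → Term D np nh nd → Term D np nh nd → Formula D np nh nd
  alias    : Fin nh → Ptr np → Ptr np → Formula D np nh nd
  isPath   : Fin nh → Ptr np → Ptr np → Formula D np nh nd
  isNull   : Fin nh → Ptr np → Formula D np nh nd
  circular : Fin nh → Ptr np → Formula D np nh nd
  new      : Fin nh → Fin nh → Fin np → Formula D np nh nd
  assign   : Fin nh → Fin nh → Fin np → Ptr np → Formula D np nh nd
  lookup   : Fin nh → Fin nh → Fin np → Ptr np → Formula D np nh nd
  update   : Fin nh → Fin nh → Fin np → Ptr np → Formula D np nh nd
  ⊤'       : Formula D np nh nd
  ¬'_      : Formula D np nh nd → Formula D np nh nd
  _∧'_     : Formula D np nh nd → Formula D np nh nd → Formula D np nh nd
  _∨'_     : Formula D np nh nd → Formula D np nh nd → Formula D np nh nd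

record Interp (D : Set) (np nh nd : ℕ) : Set where
  field
    heap : Fin nh → Heap np
    dval : Fin nd → D
open Interp public

module _ {D : Set} (emb : ℕ∞ → D) {np nh nd : ℕ} (Γ : Interp D np nh nd) where

  EvalT : Term D np nh nd → D → Set
  EvalT (dvar i)           d = d ≡ dval Γ i
  EvalT (const c)          d = d ≡ c
  EvalT (app f t₁ t₂)      d = Σ D λ d₁ → Σ D λ d₂ → EvalT t₁ d₁ × EvalT t₂ d₂ × d ≡ f d₁ d₂
  EvalT (pathLength h x y) d = Σ ℕ∞ λ n →
    PathLen (heap Γ h) (L (heap Γ h) x) (L (heap Γ h) y) n × d ≡ emb n

  Trans : (Heap np → Heap np → Set) → Fin nh → Fin nh → Set
  Trans T h' h = Σ (Heap np) λ H'' → T (heap Γ h) H'' × Homeo (heap Γ h') H''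

  ⟦_⟧ : Formula D np nh nd → Set
  ⟦ rel R t₁ t₂ ⟧ = Σ D λ d₁ → Σ D λ d₂ → EvalT t₁ d₁ × EvalT t₂ d₂ × R d₁ d₂
  ⟦ alias h x y ⟧ = L (heap Γ h) x ≡ L (heap Γ h) y
  ⟦ isPath h x y ⟧ = HasPath (heap Γ h) (L (heap Γ h) x) (L (heap Γ h) y)
  ⟦ isNull h x ⟧ = L (heap Γ h) x ≡ L (heap Γ h) null
  ⟦ circular h x ⟧ = Cyclic (heap Γ h) (L (heap Γ h) x)
  ⟦ new h' h x ⟧ = Trans (λ H H'' → New H x H'') h' h
  ⟦ assign h' h x y ⟧ = Trans (λ H H'' → Assign H x y H'') h' h
  ⟦ lookup h' h x y ⟧ = Trans (λ H H'' → Lookup H x y H'') h' h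
  ⟦ update h' h x y ⟧ = Trans (λ H H'' → Update H x y H'') h' h
  ⟦ ⊤' ⟧ = ⊤
  ⟦ ¬' φ ⟧ = ¬ ⟦ φ ⟧
  ⟦ φ ∧' ψ ⟧ = ⟦ φ ⟧ × ⟦ ψ ⟧
  ⟦ φ ∨' ψ ⟧ = ⟦ φ ⟧ ⊎ ⟦ ψ ⟧

module Submission where

-- Homeomorphism is captured by the "unfolding" of a heap: every
-- edge of weight w is replaced by w unit steps, giving a pointed graph on
-- positions (vertex , offset) with a partial successor and the pointer
-- variables as roots; two unfoldings are compared on their parts
-- reachable from the roots (_≅_, an equivalence relation).
--   * Walks of weight k are exactly k-step runs of the unfolding between
--     vertices, so alias, isPath, isNull, circular and pathLength only
--     depend on the unfolding up to _≅_.
--   * Homeo A B holds iff unfold A ≅ unfold B: one edge subdivision does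
--     not change the unfolding, and every heap subdivides into a heap with
--     unit weights, on which _≅_ is an isomorphism of reachable parts.
--   * new, assign, lookup and update respect _≅_; hence truth of every
--     formula is invariant under replacing the heaps of an interpretation
--     by heaps with isomorphic unfoldings (holds-similar).
--   * Every heap has a kernel with isomorphic unfolding: delete
--     unreachable vertices and smooth away smoothable ones, by induction
--     on the number of vertices.
-- The theorem replaces every heap of the counterexample by its kernel.

open import Defs
open import Data.Nat using (ℕ)
open import Data.Fin using (Fin)
open import Data.Product using (Σ; _×_)
open import Relation.Nullary using (¬_)

open import Data.Bool using (if_then_else_)
open import Data.Bool.Properties using (if-float)
open import Data.Empty using (⊥-elim)
open import Data.Fin using (zero; suc; _≟_; punchIn; punchOut; toℕ; fromℕ<)
open import Data.Fin.Properties
  using (suc-injective; any?; all?; ¬Fin0; pigeonhole; toℕ<n; toℕ-fromℕ<;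
         punchIn-injective; punchInᵢ≢i; punchIn-punchOut)
open import Data.Maybe using (Maybe; just; nothing; _>>=_)
import Data.Maybe as Maybe
open import Data.Maybe.Properties using (just-injective; map-∘; map-id; map-just)
open import Data.Nat using (zero; suc; _+_; _∸_; _≤_; _<_; s≤s; s≤s⁻¹; z≤n; z<s; _<?_; pred)
open import Data.Nat.Properties
  using (+-assoc; +-comm; +-suc; +-identityʳ; +-cancelʳ-≡; +-cancelˡ-<; +-monoʳ-<; +-monoˡ-<;
         1+n≢0; <-irrefl; <-≤-trans; ≤-<-trans; ≤-refl; ≤-reflexive; ≤-trans; ≮⇒≥;
         m+[n∸m]≡n; m+n∸m≡n; m<m+n; m≤m+n; m≤n+m; m≤n⇒m∸n≡0; m≤n⇒∃[o]m+o≡n;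
         n<1+n; n<1⇒n≡0; n≤1+n)
  renaming (_≟_ to _≟ℕ_)
open import Data.Nat.Solver using (module +-*-Solver)
open import Data.Product using (_,_; proj₁; proj₂; map₁)
open import Data.Product.Properties using (≡-dec)
open import Data.Sum using (_⊎_; inj₁; inj₂)
open import Function using (_∘_)
open import Relation.Binary.Construct.Closure.ReflexiveTransitive using (ε; _◅_)
open import Relation.Binary.Definitions using (DecidableEquality)
open import Relation.Binary.PropositionalEquality
  using (_≡_; _≢_; refl; sym; trans; cong; cong₂; subst; subst₂; module ≡-Reasoning)
open import Relation.Nullary using (yes; no; Dec; does)
open import Relation.Nullary.Decidable using (dec-true; dec-false; ¬?; _×-dec_; _→-dec_; decidable-stable)

nothing≢just : ∀ {A : Set} {a : A} → nothing ≢ just a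
nothing≢just ()

map-cong-on : ∀ {A B : Set} {f g : A → B} (m : Maybe A) →
  (∀ a → m ≡ just a → f a ≡ g a) → Maybe.map f m ≡ Maybe.map g m
map-cong-on nothing  _   = refl
map-cong-on (just a) fga = cong just (fga a refl)

map-just-inv : ∀ {A B : Set} {f : A → B} (m : Maybe A) {b : B} →
  Maybe.map f m ≡ just b → Σ A λ a → m ≡ just a × f a ≡ b
map-just-inv (just a) e = a , refl , just-injective e

record Pointed (np : ℕ) : Set₁ where
  field
    Node  : Set
    succ  : Node → Maybe Node
    label : Ptr np → Node
open Pointed

module _ {np : ℕ} where

  data Reachable (G : Pointed np) : Node G → Set where
    root : ∀ p → Reachable G (label G p)
    step : ∀ {c d} → Reachable G c → succ G c ≡ just d → Reachable G d

  iterate : (G : Pointed np) → ℕ → Node G → Maybe (Node G)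
  iterate G zero    c = just c
  iterate G (suc k) c = succ G c >>= iterate G k

  record _≅_ (G G′ : Pointed np) : Set where
    field
      to       : Node G → Node G′
      from     : Node G′ → Node G
      to-label : ∀ p → to (label G p) ≡ label G′ p
      to-succ  : ∀ c → Reachable G c → succ G′ (to c) ≡ Maybe.map to (succ G c)
      from-to  : ∀ c → Reachable G c → from (to c) ≡ c
      to-from  : ∀ c → Reachable G′ c → to (from c) ≡ c

  module _ {G G′ : Pointed np} (I : G ≅ G′) where
    open _≅_ I

    to-reach : ∀ {c} → Reachable G c → Reachable G′ (to c)
    to-reach (root p) = subst (Reachable G′) (sym (to-label p)) (root p)
    to-reach (step {c} r e) = step (to-reach r) (trans (to-succ c r) (cong (Maybe.map to) e))

    from-label : ∀ p → from (label G′ p) ≡ label G p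
    from-label p = trans (cong from (sym (to-label p))) (from-to _ (root p))

    succ-via-from : ∀ c → Reachable G′ c → Reachable G (from c) →
      succ G′ c ≡ Maybe.map to (succ G (from c))
    succ-via-from c r rf = trans (cong (succ G′) (sym (to-from c r))) (to-succ (from c) rf)

    from-reach : ∀ {c} → Reachable G′ c → Reachable G (from c)
    from-reach (root p) = subst (Reachable G) (sym (from-label p)) (root p)
    from-reach (step {c} {d} r e)
      with map-just-inv (succ G (from c)) (trans (sym (succ-via-from c r (from-reach r))) e)
    ... | d′ , e′ , to-d′≡d =
      subst (Reachable G) (trans (sym (from-to d′ (step (from-reach r) e′))) (cong from to-d′≡d))
            (step (from-reach r) e′)

    from-succ : ∀ c → Reachable G′ c → succ G (from c) ≡ Maybe.map from (succ G′ c)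
    from-succ c r = sym (begin
      Maybe.map from (succ G′ c)                    ≡⟨ cong (Maybe.map from) (succ-via-from c r rf) ⟩
      Maybe.map from (Maybe.map to (succ G (from c))) ≡⟨ map-∘ (succ G (from c)) ⟨
      Maybe.map (from ∘ to) (succ G (from c))       ≡⟨ map-cong-on _ (λ d e → from-to d (step rf e)) ⟩
      Maybe.map (λ d → d) (succ G (from c))         ≡⟨ map-id (succ G (from c)) ⟩
      succ G (from c)                               ∎)
      where
        open ≡-Reasoning
        rf = from-reach r

    label-step : ∀ p {d} → succ G (label G p) ≡ just d → succ G′ (label G′ p) ≡ just (to d)
    label-step p e = trans (cong (succ G′) (sym (to-label p))) (trans (to-succ _ (root p)) (cong (Maybe.map to) e))

    to-injective : ∀ {c e} → Reachable G c → Reachable G e → to c ≡ to e → c ≡ e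
    to-injective {c} {e} rc re eq = trans (sym (from-to c rc)) (trans (cong from eq) (from-to e re))

    iterate-to : ∀ k {c d} → Reachable G c → iterate G k c ≡ just d → iterate G′ k (to c) ≡ just (to d)
    iterate-to zero    r refl = refl
    iterate-to (suc k) {c} r e with succ G c in sc
    ... | just c′ rewrite to-succ c r | sc = iterate-to k (step r sc) e

  ≅-refl : ∀ {G} → G ≅ G
  ≅-refl {G} = record
    { to = λ c → c ; from = λ c → c ; to-label = λ _ → refl
    ; to-succ = λ c _ → sym (map-id (succ G c))
    ; from-to = λ _ _ → refl ; to-from = λ _ _ → refl }

  ≅-sym : ∀ {G G′} → G ≅ G′ → G′ ≅ G
  ≅-sym I = record
    { to = from ; from = to ; to-label = from-label I ; to-succ = from-succ I
    ; from-to = to-from ; to-from = from-to }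
    where open _≅_ I

  ≅-trans : ∀ {G₁ G₂ G₃} → G₁ ≅ G₂ → G₂ ≅ G₃ → G₁ ≅ G₃
  ≅-trans {G₁} I J = record
    { to = J.to ∘ I.to ; from = I.from ∘ J.from
    ; to-label = λ p → trans (cong J.to (I.to-label p)) (J.to-label p)
    ; to-succ = λ c r → trans (J.to-succ _ (to-reach I r))
        (trans (cong (Maybe.map J.to) (I.to-succ c r)) (sym (map-∘ (succ G₁ c))))
    ; from-to = λ c r → trans (cong I.from (J.from-to _ (to-reach I r))) (I.from-to c r)
    ; to-from = λ c r → trans (cong J.to (I.to-from _ (from-reach J r))) (J.to-from c r) }
    where
      module I = _≅_ I
      module J = _≅_ J

  iterate-+ : ∀ (G : Pointed np) m n c → iterate G (m + n) c ≡ (iterate G m c >>= iterate G n)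
  iterate-+ G zero    n c = refl
  iterate-+ G (suc m) n c with succ G c
  ... | nothing = refl
  ... | just c′ = iterate-+ G m n c′

  iterate-then : ∀ (G : Pointed np) m n {c d} → iterate G m c ≡ just d → iterate G (m + n) c ≡ iterate G n d
  iterate-then G m n {c} e = trans (iterate-+ G m n c) (cong (_>>= iterate G n) e)

  iterate-reach : ∀ (G : Pointed np) k {c d} → Reachable G c → iterate G k c ≡ just d → Reachable G d
  iterate-reach G zero    r refl = r
  iterate-reach G (suc k) {c} r e with succ G c in sc
  ... | just c′ = iterate-reach G k (step r sc) e

-- The number of unit positions on the edge leaving a vertex
-- (the sink has the single position 0).
span : ∀ {A : Set} → Maybe (A × ℕ) → ℕ
span nothing        = 1
span (just (_ , w)) = w

stepOn : ∀ {n} → Fin n → ℕ → Maybe (Fin n × ℕ) → Maybe (Fin n × ℕ)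
stepOn a k nothing = nothing
stepOn a k (just (t , w)) with suc k <? w
... | yes _ = just (a , suc k)
... | no _  = just (t , 0)

module _ {np : ℕ} where

  -- The unfolding of a heap: the heap with every edge of weight w
  -- subdivided into w unit edges, presented as a pointed graph on
  -- positions (a , k) = "k units along the edge leaving a".
  unfold : Heap np → Pointed np
  unfold H = record
    { Node  = Fin (V H) × ℕ
    ; succ  = λ { (a , k) → stepOn a k (next H a) }
    ; label = λ p → L H p , 0 }

  module _ (H : Heap np) where

    step-inside : ∀ {a t w k} → next H a ≡ just (t , w) → suc k < w →
      succ (unfold H) (a , k) ≡ just (a , suc k)
    step-inside {w = w} {k = k} e lt rewrite e with suc k <? w
    ... | yes _ = refl
    ... | no ¬lt = ⊥-elim (¬lt lt)

    step-across : ∀ {a t w k} → next H a ≡ just (t , w) → ¬ suc k < w →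
      succ (unfold H) (a , k) ≡ just (t , 0)
    step-across {w = w} {k = k} e ¬lt rewrite e with suc k <? w
    ... | yes lt = ⊥-elim (¬lt lt)
    ... | no _ = refl

    step-stuck : ∀ {a k} → next H a ≡ nothing → succ (unfold H) (a , k) ≡ nothing
    step-stuck e rewrite e = refl

    iterate-along : ∀ {a t w} → next H a ≡ just (t , w) →
      ∀ j i → i + j < w → iterate (unfold H) j (a , i) ≡ just (a , i + j)
    iterate-along e zero i lt = cong (λ k → just (_ , k)) (sym (+-identityʳ i))
    iterate-along {w = w} e (suc j) i lt
      rewrite step-inside e (≤-<-trans (m≤m+n (suc i) j) (subst (_< w) (+-suc i j) lt))
            | +-suc i j
      = iterate-along e j (suc i) lt

    iterate-across : ∀ {a t w} → next H a ≡ just (t , w) →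
      ∀ j i → i + suc j ≡ w → iterate (unfold H) (suc j) (a , i) ≡ just (t , 0)
    iterate-across e zero i eq
      rewrite step-across e (<-irrefl (trans (+-comm 1 i) eq)) = refl
    iterate-across e (suc j) i eq
      rewrite step-inside e (subst (suc i <_) eq (subst (suc i <_) (sym (+-suc i (suc j))) (m<m+n (suc i) z<s)))
      = iterate-across e j (suc i) (trans (sym (+-suc i (suc j))) eq)

    iterate-edge : ∀ {a t w} → next H a ≡ just (t , w) → iterate (unfold H) w (a , 0) ≡ just (t , 0)
    iterate-edge {a} {t} {w} e with weight-pos H a t w e
    ... | s≤s {n = w′} _ = iterate-across e w′ 0 refl

    walk→iterate : ∀ {u v k} → Walk H u v k → iterate (unfold H) k (u , 0) ≡ just (v , 0)
    walk→iterate []                    = refl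
    walk→iterate (_∷_ {w = w} e walk) = trans (iterate-then (unfold H) w _ (iterate-edge e)) (walk→iterate walk)

    -- Conversely; the fuel bounds the length so that recursion is structural.
    iterate→walk′ : ∀ fuel k {u v} → k ≤ fuel → iterate (unfold H) k (u , 0) ≡ just (v , 0) → Walk H u v k
    iterate→walk′ fuel zero _ refl = []
    iterate→walk′ (suc fuel) (suc k) {u} {v} (s≤s k≤fuel) run = leave (next H u) refl
      where
        -- the run leaves u along its edge, crosses it completely (w steps)
        -- and continues for r = k + 1 - w further steps
        leave : ∀ m → next H u ≡ m → Walk H u v (suc k)
        leave nothing eu =
          ⊥-elim (nothing≢just (trans (sym (cong (_>>= iterate (unfold H) k) (step-stuck eu))) run))
        leave (just (t , w)) eu with suc k <? w
        ... | yes k<w =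
          ⊥-elim (1+n≢0 (cong proj₂ (just-injective (trans (sym (iterate-along eu (suc k) 0 k<w)) run))))
        ... | no k≮w with weight-pos H u t w eu | m≤n⇒∃[o]m+o≡n (≮⇒≥ k≮w)
        ...   | s≤s {n = w′} _ | r , w+r≡k =
          subst (Walk H u v) w+r≡k (eu ∷ iterate→walk′ fuel r r≤fuel rest)
          where
            r≤fuel : r ≤ fuel
            r≤fuel = ≤-trans (m≤n+m r w′) (≤-trans (≤-reflexive (cong pred w+r≡k)) k≤fuel)
            rest : iterate (unfold H) r (t , 0) ≡ just (v , 0)
            rest = trans (sym (iterate-then (unfold H) w r (iterate-edge eu)))
                         (trans (cong (λ n → iterate (unfold H) n (u , 0)) w+r≡k) run)

    iterate→walk : ∀ {u v} k → iterate (unfold H) k (u , 0) ≡ just (v , 0) → Walk H u v k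
    iterate→walk k = iterate→walk′ k k ≤-refl

    walk-snoc : ∀ {u a k t w} → Walk H u a k → next H a ≡ just (t , w) → Walk H u t (k + w)
    walk-snoc [] e = subst (Walk H _ _) (+-identityʳ _) (e ∷ [])
    walk-snoc (_∷_ {w = w′} {k = k′} e′ walk) e =
      subst (Walk H _ _) (sym (+-assoc w′ k′ _)) (e′ ∷ walk-snoc walk e)

    reach→reachable : ∀ {a} → Reach H a → Reachable (unfold H) (a , 0)
    reach→reachable (p , k , walk) = iterate-reach (unfold H) k (root p) (walk→iterate walk)

    reachable→reach : ∀ {a k} → Reachable (unfold H) (a , k) → Reach H a
    reachable→reach (root p) = p , 0 , []
    reachable→reach (step {c = a , k} r e) with next H a in ea
    ... | just (t , w) with suc k <? w
    reachable→reach (step r refl) | just (t , w) | yes _ = reachable→reach r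
    reachable→reach (step r refl) | just (t , w) | no _ with reachable→reach r
    ... | p , m , walk = p , m + w , walk-snoc walk ea

    span-pos : ∀ a → 1 ≤ span (next H a)
    span-pos a with next H a in ea
    ... | nothing = s≤s z≤n
    ... | just (t , w) = weight-pos H a t w ea

    reachable-offset : ∀ {a k} → Reachable (unfold H) (a , k) → k < span (next H a)
    reachable-offset (root p) = span-pos (L H p)
    reachable-offset (step {c = a , k} r e) with next H a in ea
    ... | just (t , w) with suc k <? w
    reachable-offset (step r refl) | just (t , w) | yes lt rewrite ea = lt
    reachable-offset (step r refl) | just (t , w) | no _ = span-pos t

stepOn-rename : ∀ {n n′} (F : Fin n → Fin n′) a k (m : Maybe (Fin n × ℕ)) →
  stepOn (F a) k (Maybe.map (map₁ F) m) ≡ Maybe.map (map₁ F) (stepOn a k m)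
stepOn-rename F a k nothing = refl
stepOn-rename F a k (just (t , w)) with suc k <? w
... | yes _ = refl
... | no _  = refl

stepOn-lands : ∀ {n} (a : Fin n) k m {b j} → stepOn a k m ≡ just (b , j) → b ≡ a ⊎ j ≡ 0
stepOn-lands a k (just (t , w)) e with suc k <? w
stepOn-lands a k (just (t , w)) refl | yes _ = inj₁ refl
stepOn-lands a k (just (t , w)) refl | no _  = inj₂ refl

module _ {np : ℕ} {H₁ H₂ : Heap np} (I : unfold H₁ ≅ unfold H₂) where
  open _≅_ I

  iterate-labels : ∀ k x y → iterate (unfold H₁) k (L H₁ x , 0) ≡ just (L H₁ y , 0) →
    iterate (unfold H₂) k (L H₂ x , 0) ≡ just (L H₂ y , 0)
  iterate-labels k x y e =
    subst₂ (λ a b → iterate (unfold H₂) k a ≡ just b) (to-label x) (to-label y) (iterate-to I k (root x) e)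

  alias-≅ : ∀ x y → L H₁ x ≡ L H₁ y → L H₂ x ≡ L H₂ y
  alias-≅ x y e = cong proj₁ (just-injective (iterate-labels 0 x y (cong (λ a → just (a , 0)) e)))

  walk-≅ : ∀ {k} x y → Walk H₁ (L H₁ x) (L H₁ y) k → Walk H₂ (L H₂ x) (L H₂ y) k
  walk-≅ {k} x y walk = iterate→walk H₂ k (iterate-labels k x y (walk→iterate H₁ walk))

  hasPath-≅ : ∀ x y → HasPath H₁ (L H₁ x) (L H₁ y) → HasPath H₂ (L H₂ x) (L H₂ y)
  hasPath-≅ x y (k , walk) = k , walk-≅ x y walk

cyclic→walk : ∀ {np} {H : Heap np} {u} → Cyclic H u → Σ ℕ λ n → Walk H u u (suc n)
cyclic→walk {H = H} {u} (v , w , k , e , walk) with weight-pos H u v w e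
... | s≤s {n = w′} _ = w′ + k , (e ∷ walk)

walk→cyclic : ∀ {np} {H : Heap np} {u n} → Walk H u u (suc n) → Cyclic H u
walk→cyclic walk = closed-walk walk z<s refl
  where
    closed-walk : ∀ {np} {H : Heap np} {u x m} → Walk H u x m → 0 < m → x ≡ u → Cyclic H u
    closed-walk (_∷_ {v = v} {w = w} {k = k} e walk) _ refl = v , w , k , e , walk

module _ {np : ℕ} {H₁ H₂ : Heap np} (I : unfold H₁ ≅ unfold H₂) where

  cyclic-≅ : ∀ x → Cyclic H₁ (L H₁ x) → Cyclic H₂ (L H₂ x)
  cyclic-≅ x c = walk→cyclic (walk-≅ I x x (proj₂ (cyclic→walk c)))

  -- minimality of a path length transfers along the inverse isomorphism
  pathLen-≅ : ∀ x y n → PathLen H₁ (L H₁ x) (L H₁ y) n → PathLen H₂ (L H₂ x) (L H₂ y) n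
  pathLen-≅ x y (fin k) (walk , minimal) =
    walk-≅ I x y walk , λ k′ walk′ → minimal k′ (walk-≅ (≅-sym I) x y walk′)
  pathLen-≅ x y ∞ no-walk (k , walk) = no-walk (k , walk-≅ (≅-sym I) x y walk)

-- A single edge subdivision does not change the unfolding: positions on
-- the split edge beyond w₁ become positions on the new edge out of q.
module Subdivided {np : ℕ} {H H′ : Heap np} (s : Subdiv1 H H′) where
  open Subdiv1 s

  w₁-pos : 0 < w₁
  w₁-pos = weight-pos H′ (ι u) q w₁ edge-u

  w₂-pos : 0 < w₂
  w₂-pos = weight-pos H′ q (ι v) w₂ edge-q

  split : Fin (V H) × ℕ → Fin (V H′) × ℕ
  split (a , k) with a ≟ u | k <? w₁
  ... | yes _ | no _  = q , k ∸ w₁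
  ... | yes _ | yes _ = ι a , k
  ... | no _  | _     = ι a , k

  split-old : ∀ {a k} → a ≢ u ⊎ k < w₁ → split (a , k) ≡ (ι a , k)
  split-old {a} {k} off with a ≟ u | k <? w₁
  split-old (inj₁ a≢u) | yes a≡u | no _   = ⊥-elim (a≢u a≡u)
  split-old (inj₂ k<w₁) | yes _  | no k≮w₁ = ⊥-elim (k≮w₁ k<w₁)
  ... | yes _ | yes _ = refl
  ... | no _  | _     = refl

  split-new : ∀ {k} → ¬ k < w₁ → split (u , k) ≡ (q , k ∸ w₁)
  split-new {k} k≮w₁ with u ≟ u | k <? w₁
  ... | yes _ | no _      = refl
  ... | yes _ | yes k<w₁  = ⊥-elim (k≮w₁ k<w₁)
  ... | no u≢u | _        = ⊥-elim (u≢u refl)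

  split-beyond : ∀ r → split (u , w₁ + r) ≡ (q , r)
  split-beyond r = trans (split-new w₁+r≮w₁) (cong (q ,_) (m+n∸m≡n w₁ r))
    where
      w₁+r≮w₁ : ¬ w₁ + r < w₁
      w₁+r≮w₁ lt = <-irrefl refl (≤-<-trans (m≤m+n w₁ r) lt)

  merge : Fin (V H′) × ℕ → Fin (V H) × ℕ
  merge (b , k) with cover b
  ... | inj₁ _       = u , w₁ + k
  ... | inj₂ (a , _) = a , k

  merge-old : ∀ a k → merge (ι a , k) ≡ (a , k)
  merge-old a k with cover (ι a)
  ... | inj₁ ιa≡q      = ⊥-elim (fresh a ιa≡q)
  ... | inj₂ (a′ , e) = cong (_, k) (ι-inj a′ a e)

  merge-new : ∀ k → merge (q , k) ≡ (u , w₁ + k)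
  merge-new k with cover q
  ... | inj₁ _        = refl
  ... | inj₂ (a , e) = ⊥-elim (fresh a e)

  private
    succ₁ = succ (unfold H)
    succ₂ = succ (unfold H′)

    commute : ∀ {c d d′} → succ₂ (split c) ≡ just d′ → succ₁ c ≡ just d → split d ≡ d′ →
      succ₂ (split c) ≡ Maybe.map split (succ₁ c)
    commute e₂ e₁ sd = trans e₂ (sym (trans (map-just e₁) (cong just sd)))

  -- away from u both heaps have the same edge
  split-succ-off : ∀ {a} k → a ≢ u → succ₂ (split (a , k)) ≡ Maybe.map split (succ₁ (a , k))
  split-succ-off {a} k a≢u = begin
    succ₂ (split (a , k))                        ≡⟨ cong succ₂ (split-old (inj₁ a≢u)) ⟩
    stepOn (ι a) k (next H′ (ι a))               ≡⟨ cong (stepOn (ι a) k) (other a a≢u) ⟩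
    stepOn (ι a) k (Maybe.map (map₁ ι) (next H a)) ≡⟨ stepOn-rename ι a k (next H a) ⟩
    Maybe.map (map₁ ι) (succ₁ (a , k))           ≡⟨ map-cong-on (succ₁ (a , k)) lands-old ⟨
    Maybe.map split (succ₁ (a , k))              ∎
    where
      open ≡-Reasoning
      lands-old : ∀ d → succ₁ (a , k) ≡ just d → split d ≡ map₁ ι d
      lands-old (b , j) e with stepOn-lands a k (next H a) e
      ... | inj₁ refl = split-old (inj₁ a≢u)
      ... | inj₂ refl = split-old (inj₂ w₁-pos)

  split-succ-first : ∀ {k} → k < w₁ → succ₂ (split (u , k)) ≡ Maybe.map split (succ₁ (u , k))
  split-succ-first {k} k<w₁ with suc k <? w₁
  ... | yes k+1<w₁ = commute
          (trans (cong succ₂ (split-old (inj₂ k<w₁))) (step-inside H′ edge-u k+1<w₁))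
          (step-inside H edge (≤-trans k+1<w₁ (m≤m+n w₁ w₂)))
          (split-old (inj₂ k+1<w₁))
  ... | no k+1≮w₁ = commute
          (trans (cong succ₂ (split-old (inj₂ k<w₁))) (step-across H′ edge-u k+1≮w₁))
          (step-inside H edge (<-≤-trans (s≤s k<w₁) (m<m+n w₁ w₂-pos)))
          (trans (split-new k+1≮w₁) (cong (q ,_) (m≤n⇒m∸n≡0 k<w₁)))

  split-succ-second : ∀ r → succ₂ (split (u , w₁ + r)) ≡ Maybe.map split (succ₁ (u , w₁ + r))
  split-succ-second r with suc r <? w₂
  ... | yes r+1<w₂ = commute
          (trans (cong succ₂ (split-beyond r)) (step-inside H′ edge-q r+1<w₂))
          (step-inside H edge (subst (_< w₁ + w₂) (+-suc w₁ r) (+-monoʳ-< w₁ r+1<w₂)))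
          (trans (cong (λ j → split (u , j)) (sym (+-suc w₁ r))) (split-beyond (suc r)))
  ... | no r+1≮w₂ = commute
          (trans (cong succ₂ (split-beyond r)) (step-across H′ edge-q r+1≮w₂))
          (step-across H edge λ lt →
            r+1≮w₂ (+-cancelˡ-< w₁ _ _ (subst (_< w₁ + w₂) (sym (+-suc w₁ r)) lt)))
          (split-old (inj₂ w₁-pos))

  split-succ-beyond : ∀ {k} → ¬ k < w₁ → succ₂ (split (u , k)) ≡ Maybe.map split (succ₁ (u , k))
  split-succ-beyond k≮w₁ with m≤n⇒∃[o]m+o≡n (≮⇒≥ k≮w₁)
  ... | r , refl = split-succ-second r

  split-succ : ∀ c → Reachable (unfold H) c → succ₂ (split c) ≡ Maybe.map split (succ₁ c)
  split-succ (a , k) _ = by-vertex (a ≟ u) (k <? w₁)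
    where
      by-vertex : Dec (a ≡ u) → Dec (k < w₁) → succ₂ (split (a , k)) ≡ Maybe.map split (succ₁ (a , k))
      by-vertex (no a≢u)   _          = split-succ-off k a≢u
      by-vertex (yes refl) (yes k<w₁) = split-succ-first k<w₁
      by-vertex (yes refl) (no k≮w₁)  = split-succ-beyond k≮w₁

  merge-split : ∀ c → Reachable (unfold H) c → merge (split c) ≡ c
  merge-split (a , k) _ = by-vertex (a ≟ u) (k <? w₁)
    where
      by-vertex : Dec (a ≡ u) → Dec (k < w₁) → merge (split (a , k)) ≡ (a , k)
      by-vertex (no a≢u) _ = trans (cong merge (split-old (inj₁ a≢u))) (merge-old a k)
      by-vertex (yes refl) (yes k<w₁) = trans (cong merge (split-old (inj₂ k<w₁))) (merge-old u k)
      by-vertex (yes refl) (no k≮w₁) = begin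
        merge (split (u , k))  ≡⟨ cong merge (split-new k≮w₁) ⟩
        merge (q , k ∸ w₁)     ≡⟨ merge-new (k ∸ w₁) ⟩
        (u , w₁ + (k ∸ w₁))    ≡⟨ cong (u ,_) (m+[n∸m]≡n (≮⇒≥ k≮w₁)) ⟩
        (u , k)                ∎
        where open ≡-Reasoning

  split-merge : ∀ c → Reachable (unfold H′) c → split (merge c) ≡ c
  split-merge (b , k) reach with cover b
  ... | inj₁ refl = split-beyond k
  ... | inj₂ (a , refl) = split-old (off-or-inside (a ≟ u))
    where
      -- at ι u, reachable offsets lie on the first part of the split edge
      off-or-inside : Dec (a ≡ u) → a ≢ u ⊎ k < w₁
      off-or-inside (no a≢u)  = inj₁ a≢u
      off-or-inside (yes refl) = inj₂ (subst (λ m → k < span m) edge-u (reachable-offset H′ reach))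

  subdiv-≅ : unfold H ≅ unfold H′
  subdiv-≅ = record
    { to = split ; from = merge
    ; to-label = λ p → trans (split-old (inj₂ w₁-pos)) (cong (_, 0) (sym (lab p)))
    ; to-succ = split-succ ; from-to = merge-split ; to-from = split-merge }

module _ {np : ℕ} where

  subdivision-≅ : ∀ {H H′ : Heap np} → Subdivision H H′ → unfold H ≅ unfold H′
  subdivision-≅ ε        = ≅-refl
  subdivision-≅ (s ◅ ss) = ≅-trans (Subdivided.subdiv-≅ s) (subdivision-≅ ss)

  reachIso-≅ : ∀ {S S′ : Heap np} → ReachIso S S′ → unfold S ≅ unfold S′
  reachIso-≅ {S} {S′} R = record
    { to = map₁ f ; from = map₁ g
    ; to-label = λ p → cong (_, 0) (lab p)
    ; to-succ = λ { (a , k) r → trans (cong (stepOn (f a) k) (edges a (reachable→reach S r)))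
                                      (stepOn-rename f a k (next S a)) }
    ; from-to = λ { (a , k) r → cong (_, k) (gf a (reachable→reach S r)) }
    ; to-from = λ { (a , k) r → cong (_, k) (fg a (reachable→reach S′ r)) } }
    where open ReachIso R

  homeo→≅ : ∀ {A B : Heap np} → Homeo A B → unfold A ≅ unfold B
  homeo→≅ (S , S′ , A⇝S , B⇝S′ , R) =
    ≅-trans (subdivision-≅ A⇝S) (≅-trans (reachIso-≅ R) (≅-sym (subdivision-≅ B⇝S′)))

sumFin : ∀ {n} → (Fin n → ℕ) → ℕ
sumFin {zero}  f = 0
sumFin {suc n} f = f zero + sumFin (f ∘ suc)

sumFin-cong : ∀ {n} {f g : Fin n → ℕ} → (∀ a → f a ≡ g a) → sumFin f ≡ sumFin g
sumFin-cong {zero}  f≗g = refl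
sumFin-cong {suc n} f≗g = cong₂ _+_ (f≗g zero) (sumFin-cong (f≗g ∘ suc))

sumFin-point : ∀ {n} (f g : Fin n → ℕ) u → (∀ a → a ≢ u → f a ≡ g a) →
  sumFin f + g u ≡ sumFin g + f u
sumFin-point f g zero f≗g
  rewrite sumFin-cong {f = f ∘ suc} {g = g ∘ suc} (λ a → f≗g (suc a) λ ())
  = solve 3 (λ a b c → (a :+ c) :+ b := (b :+ c) :+ a) refl (f zero) (g zero) (sumFin (g ∘ suc))
  where open +-*-Solver
sumFin-point f g (suc u) f≗g rewrite f≗g zero (λ ()) = begin
  (g zero + sumFin (f ∘ suc)) + g (suc u) ≡⟨ +-assoc (g zero) _ _ ⟩
  g zero + (sumFin (f ∘ suc) + g (suc u)) ≡⟨ cong (g zero +_) (sumFin-point (f ∘ suc) (g ∘ suc) u off-u) ⟩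
  g zero + (sumFin (g ∘ suc) + f (suc u)) ≡⟨ +-assoc (g zero) _ _ ⟨
  (g zero + sumFin (g ∘ suc)) + f (suc u) ∎
  where
    open ≡-Reasoning
    off-u : ∀ a → a ≢ u → f (suc a) ≡ g (suc a)
    off-u a a≢u = f≗g (suc a) (a≢u ∘ suc-injective)

module _ {np : ℕ} where

  module SplitFirstUnit (H : Heap np) (u t : Fin (V H)) (m : ℕ)
                        (e : next H u ≡ just (t , suc (suc m))) where

    next′ : Fin (suc (V H)) → Maybe (Fin (suc (V H)) × ℕ)
    next′ zero    = just (suc t , suc m)
    next′ (suc a) with a ≟ u
    ... | yes _ = just (zero , 1)
    ... | no _  = Maybe.map (map₁ suc) (next H a)

    next′-u : next′ (suc u) ≡ just (zero , 1)
    next′-u with u ≟ u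
    ... | yes _  = refl
    ... | no u≢u = ⊥-elim (u≢u refl)

    next′-other : ∀ a → a ≢ u → next′ (suc a) ≡ Maybe.map (map₁ suc) (next H a)
    next′-other a a≢u with a ≟ u
    ... | yes a≡u = ⊥-elim (a≢u a≡u)
    ... | no _    = refl

    H′ : Heap np
    H′ = record
      { V = suc (V H) ; next = next′ ; L = λ p → suc (L H p)
      ; weight-pos = weight-pos′ ; sink-null = sink-null′ ; null-sink = null-sink′ }
      where
        weight-pos′ : ∀ v t′ w → next′ v ≡ just (t′ , w) → 1 ≤ w
        weight-pos′ zero    _ _ refl = s≤s z≤n
        weight-pos′ (suc a) _ _ e′ with a ≟ u
        weight-pos′ (suc a) _ _ refl | yes _ = s≤s z≤n
        ... | no _ with next H a in ea
        weight-pos′ (suc a) _ _ refl | no _ | just (b , w) = weight-pos H a b w ea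
        sink-null′ : ∀ v → next′ v ≡ nothing → v ≡ suc (L H null)
        sink-null′ (suc a) e′ with a ≟ u
        ... | no _ with next H a in ea
        ...   | nothing = cong suc (sink-null H a ea)
        null-sink′ : next′ (suc (L H null)) ≡ nothing
        null-sink′ with L H null ≟ u
        ... | yes null≡u = ⊥-elim (nothing≢just (trans (sym (null-sink H)) (trans (cong (next H) null≡u) e)))
        ... | no _       = cong (Maybe.map (map₁ suc)) (null-sink H)

    subdiv : Subdiv1 H H′
    subdiv = record
      { ι = suc ; ι-inj = λ _ _ → suc-injective ; q = zero ; fresh = λ _ ()
      ; cover = λ { zero → inj₁ refl ; (suc a) → inj₂ (a , refl) }
      ; u = u ; v = t ; w₁ = 1 ; w₂ = suc m ; edge = e ; edge-u = next′-u ; edge-q = refl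
      ; other = next′-other ; lab = λ _ → refl }

  excess : Heap np → ℕ
  excess H = sumFin (λ a → span (next H a) ∸ 1)

  span-rename : ∀ {n n′} (F : Fin n → Fin n′) (m : Maybe (Fin n × ℕ)) →
    span (Maybe.map (map₁ F) m) ≡ span m
  span-rename F nothing  = refl
  span-rename F (just _) = refl

  excess-split : ∀ H u t m e → excess (SplitFirstUnit.H′ H u t m e) + 1 ≡ excess H
  excess-split H u t m e = begin
    (m + sumFin G) + 1  ≡⟨ +-comm (m + sumFin G) 1 ⟩
    suc (m + sumFin G)  ≡⟨ cong suc (+-comm m (sumFin G)) ⟩
    suc (sumFin G + m)  ≡⟨ +-suc (sumFin G) m ⟨
    sumFin G + suc m    ≡⟨ cong (sumFin G +_) F-u ⟨
    sumFin G + F u      ≡⟨ sumFin-point F G u F≗G ⟨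
    sumFin F + G u      ≡⟨ cong (sumFin F +_) G-u ⟩
    sumFin F + 0        ≡⟨ +-identityʳ (sumFin F) ⟩
    sumFin F            ∎
    where
      open ≡-Reasoning
      open SplitFirstUnit H u t m e
      F G : Fin (V H) → ℕ
      F a = span (next H a) ∸ 1
      G a = span (next′ (suc a)) ∸ 1
      F≗G : ∀ a → a ≢ u → F a ≡ G a
      F≗G a a≢u = cong (_∸ 1) (sym (trans (cong span (next′-other a a≢u)) (span-rename suc (next H a))))
      F-u : F u ≡ suc m
      F-u = cong (λ n → span n ∸ 1) e
      G-u : G u ≡ 0
      G-u = cong (λ n → span n ∸ 1) next′-u

  UnitWeights : Heap np → Set
  UnitWeights U = ∀ a t w → next U a ≡ just (t , w) → w ≡ 1

  HeavyEdge : (H : Heap np) → Fin (V H) → Set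
  HeavyEdge H a = Σ (Fin (V H)) λ t → Σ ℕ λ m → next H a ≡ just (t , suc (suc m))

  heavy? : (H : Heap np) → ∀ a → Dec (HeavyEdge H a)
  heavy? H a with next H a
  ... | nothing                = no λ ()
  ... | just (t , zero)        = no λ ()
  ... | just (t , suc zero)    = no λ ()
  ... | just (t , suc (suc m)) = yes (t , m , refl)

  -- Every heap can be subdivided into one with unit weights
  -- (by repeatedly splitting off units; induction on the excess).
  unitify′ : ∀ n (H : Heap np) → excess H ≡ n → Σ (Heap np) λ U → Subdivision H U × UnitWeights U
  unitify′ n H ex with any? (heavy? H)
  ... | no no-heavy = H , ε , unit
    where
      unit : UnitWeights H
      unit a t w e with weight-pos H a t w e
      unit a t (suc zero)    e | _ = refl
      unit a t (suc (suc m)) e | _ = ⊥-elim (no-heavy (a , t , m , e))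
  unitify′ zero    H ex | yes (a , t , m , e) =
    ⊥-elim (1+n≢0 (trans (+-comm 1 _) (trans (excess-split H a t m e) ex)))
  unitify′ (suc n) H ex | yes (a , t , m , e)
    with unitify′ n (SplitFirstUnit.H′ H a t m e)
           (+-cancelʳ-≡ 1 _ n (trans (excess-split H a t m e) (trans ex (+-comm 1 n))))
  ... | U , H′⇝U , unit = U , (SplitFirstUnit.subdiv H a t m e ◅ H′⇝U) , unit

  unitify : (H : Heap np) → Σ (Heap np) λ U → Subdivision H U × UnitWeights U
  unitify H = unitify′ (excess H) H refl

  unit-offset : ∀ (U : Heap np) → UnitWeights U → ∀ {a k} → Reachable (unfold U) (a , k) → k ≡ 0
  unit-offset U unit {a} {k} r with next U a in ea | reachable-offset U r
  ... | nothing      | k<1 = n<1⇒n≡0 k<1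
  ... | just (t , w) | k<w = n<1⇒n≡0 (subst (k <_) (unit a t w ea) k<w)

  unitEdge : ∀ {A : Set} → A × ℕ → A × ℕ
  unitEdge (b , _) = b , 1

  unit-next : ∀ (U : Heap np) → UnitWeights U → ∀ a →
    next U a ≡ Maybe.map unitEdge (succ (unfold U) (a , 0))
  unit-next U unit a with next U a in ea
  ... | nothing = refl
  ... | just (t , w) rewrite unit a t w ea = refl

  module UnitIso {U U′ : Heap np} (unit : UnitWeights U) (unit′ : UnitWeights U′)
                 (I : unfold U ≅ unfold U′) where
    open _≅_ I

    -- the vertex maps: reachable positions of unit-weight heaps are vertices

    vertex-to : Fin (V U) → Fin (V U′)
    vertex-to a = proj₁ (to (a , 0))

    vertex-from : Fin (V U′) → Fin (V U)
    vertex-from b = proj₁ (from (b , 0))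

    to-vertex : ∀ {a} → Reach U a → to (a , 0) ≡ (vertex-to a , 0)
    to-vertex {a} r = cong (vertex-to a ,_) (unit-offset U′ unit′ (to-reach I (reach→reachable U r)))

    from-vertex : ∀ {b} → Reach U′ b → from (b , 0) ≡ (vertex-from b , 0)
    from-vertex {b} r = cong (vertex-from b ,_) (unit-offset U unit (from-reach I (reach→reachable U′ r)))

    edges-to : ∀ a → Reach U a → next U′ (vertex-to a) ≡ Maybe.map (map₁ vertex-to) (next U a)
    edges-to a r = begin
      next U′ (vertex-to a)
        ≡⟨ unit-next U′ unit′ (vertex-to a) ⟩
      Maybe.map unitEdge (succ (unfold U′) (vertex-to a , 0))
        ≡⟨ cong (λ c → Maybe.map unitEdge (succ (unfold U′) c)) (to-vertex r) ⟨
      Maybe.map unitEdge (succ (unfold U′) (to (a , 0)))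
        ≡⟨ cong (Maybe.map unitEdge) (to-succ (a , 0) ra) ⟩
      Maybe.map unitEdge (Maybe.map to steps)
        ≡⟨ map-∘ steps ⟨
      Maybe.map (unitEdge ∘ to) steps
        ≡⟨ map-cong-on steps at-vertices ⟩
      Maybe.map (map₁ vertex-to ∘ unitEdge) steps
        ≡⟨ map-∘ steps ⟩
      Maybe.map (map₁ vertex-to) (Maybe.map unitEdge steps)
        ≡⟨ cong (Maybe.map (map₁ vertex-to)) (unit-next U unit a) ⟨
      Maybe.map (map₁ vertex-to) (next U a)
        ∎
      where
        open ≡-Reasoning
        ra = reach→reachable U r
        steps : Maybe (Fin (V U) × ℕ)
        steps = succ (unfold U) (a , 0)
        at-vertices : ∀ d → steps ≡ just d → unitEdge (to d) ≡ map₁ vertex-to (unitEdge d)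
        at-vertices (b , j) e rewrite unit-offset U unit (step ra e) = refl

    reachIso : ReachIso U U′
    reachIso = record
      { f = vertex-to ; g = vertex-from
      ; f-reach = λ a r → reachable→reach U′ (to-reach I (reach→reachable U r))
      ; g-reach = λ b r → reachable→reach U (from-reach I (reach→reachable U′ r))
      ; gf = λ a r → trans (cong (λ c → proj₁ (from c)) (sym (to-vertex r)))
                           (cong proj₁ (from-to (a , 0) (reach→reachable U r)))
      ; fg = λ b r → trans (cong (λ c → proj₁ (to c)) (sym (from-vertex r)))
                           (cong proj₁ (to-from (b , 0) (reach→reachable U′ r)))
      ; lab = λ p → cong proj₁ (to-label p)
      ; edges = edges-to }

  ≅→homeo : ∀ {A B : Heap np} → unfold A ≅ unfold B → Homeo A B
  ≅→homeo {A} {B} I with unitify A | unitify B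
  ... | UA , A⇝UA , unitA | UB , B⇝UB , unitB =
    UA , UB , A⇝UA , B⇝UB ,
    UnitIso.reachIso unitA unitB (≅-trans (≅-sym (subdivision-≅ A⇝UA)) (≅-trans I (subdivision-≅ B⇝UB)))

if-yes : ∀ {P A : Set} (d : Dec P) {a b : A} → P → (if does d then a else b) ≡ a
if-yes d p rewrite dec-true d p = refl

if-no : ∀ {P A : Set} (d : Dec P) {a b : A} → ¬ P → (if does d then a else b) ≡ b
if-no d ¬p rewrite dec-false d ¬p = refl

retarget : ∀ {np} {A : Set} → Fin np → A → (Ptr np → A) → Ptr np → A
retarget x a g null    = g null
retarget x a g (var y) = if does (x ≟ y) then a else g (var y)

retarget-map : ∀ {np} {A B : Set} (f : A → B) x a g (p : Ptr np) →
  f (retarget x a g p) ≡ retarget x (f a) (f ∘ g) p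
retarget-map f x a g null    = refl
retarget-map f x a g (var y) = if-float f (does (x ≟ y))

retarget-cong : ∀ {np} {A : Set} x (a : A) {g g′} → (∀ p → g p ≡ g′ p) → ∀ (p : Ptr np) →
  retarget x a g p ≡ retarget x a g′ p
retarget-cong x a g≗g′ null    = g≗g′ null
retarget-cong x a g≗g′ (var y) = cong (if does (x ≟ y) then a else_) (g≗g′ (var y))

module _ {np : ℕ} where

  pointed : (N : Set) → (N → Maybe N) → (Ptr np → N) → Pointed np
  pointed N s l = record { Node = N ; succ = s ; label = l }

  ≅-same : ∀ {N} {s s′ : N → Maybe N} {l l′ : Ptr np → N} → (∀ p → l p ≡ l′ p) →
    (∀ c → Reachable (pointed N s l) c → s′ c ≡ s c) → pointed N s l ≅ pointed N s′ l′
  ≅-same l≗l′ s≗s′ = record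
    { to = λ c → c ; from = λ c → c ; to-label = l≗l′
    ; to-succ = λ c r → trans (s≗s′ c r) (sym (map-id _))
    ; from-to = λ _ _ → refl ; to-from = λ _ _ → refl }

  -- The transformers on pointed graphs: x := c, x := new cell (whose
  -- successor is null; the new cell is nothing), and c.next := d.
  relabelP : (G : Pointed np) → Fin np → Node G → Pointed np
  relabelP G x c = pointed (Node G) (succ G) (retarget x c (label G))

  newP : Pointed np → Fin np → Pointed np
  newP G x = pointed (Maybe (Node G)) newSucc (retarget x nothing (just ∘ label G))
    where
      newSucc : Maybe (Node G) → Maybe (Maybe (Node G))
      newSucc nothing  = just (just (label G null))
      newSucc (just c) = Maybe.map just (succ G c)

  updateP : (G : Pointed np) → DecidableEquality (Node G) → Node G → Node G → Pointed np
  updateP G _≟ₙ_ c d = pointed (Node G) (λ e → if does (e ≟ₙ c) then just d else succ G e) (label G)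

  relabel-reach : ∀ {G x c e} → Reachable G c → Reachable (relabelP G x c) e → Reachable G e
  relabel-reach rc (root null) = root null
  relabel-reach {x = x} rc (root (var y)) with x ≟ y
  ... | yes _ = rc
  ... | no _  = root (var y)
  relabel-reach rc (step r e) = step (relabel-reach rc r) e

  update-reach : ∀ {G} dec {c d e} → Reachable G d → Reachable (updateP G dec c d) e → Reachable G e
  update-reach dec rd (root p) = root p
  update-reach dec {c} rd (step {c = e} r s) with dec e c
  update-reach dec rd (step r refl) | yes _ = rd
  ... | no _ = step (update-reach dec rd r) s

  new-reach : ∀ {G x e} → Reachable (newP G x) (just e) → Reachable G e
  new-reach {G} {x} r = go r refl
    where
      go : ∀ {m e} → Reachable (newP G x) m → m ≡ just e → Reachable G e
      go (root null) refl = root null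
      go (root (var y)) eq with x ≟ y
      go (root (var y)) ()   | yes _
      go (root (var y)) refl | no _ = root (var y)
      go (step {c = nothing} r refl) refl = root null
      go (step {c = just c} r s) refl with map-just-inv (succ G c) s
      ... | d , sc , refl = step (go r refl) sc

  relabel-cong : ∀ {G G′} (I : G ≅ G′) x {c} → Reachable G c → relabelP G x c ≅ relabelP G′ x (_≅_.to I c)
  relabel-cong {G} I x {c} rc = record
    { to = to ; from = from
    ; to-label = λ p → trans (retarget-map to x c (label G) p) (retarget-cong x (to c) to-label p)
    ; to-succ = λ e r → to-succ e (relabel-reach rc r)
    ; from-to = λ e r → from-to e (relabel-reach rc r)
    ; to-from = λ e r → to-from e (relabel-reach (to-reach I rc) r) }
    where open _≅_ I

  relabel-≡ : ∀ {G : Pointed np} {x c c′} → c ≡ c′ → relabelP G x c ≅ relabelP G x c′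
  relabel-≡ refl = ≅-refl

  new-cong : ∀ {G G′} (I : G ≅ G′) x → newP G x ≅ newP G′ x
  new-cong {G} {G′} I x = record
    { to = Maybe.map to ; from = Maybe.map from
    ; to-label = λ p → trans (retarget-map (Maybe.map to) x nothing (just ∘ label G) p)
                             (retarget-cong x nothing (cong just ∘ to-label) p)
    ; to-succ = λ { nothing _ → cong (just ∘ just) (sym (to-label null))
                  ; (just c) r → trans (cong (Maybe.map just) (to-succ c (new-reach r)))
                                       (trans (sym (map-∘ (succ G c))) (map-∘ (succ G c))) }
    ; from-to = λ { nothing _ → refl ; (just c) r → cong just (from-to c (new-reach r)) }
    ; to-from = λ { nothing _ → refl ; (just c) r → cong just (to-from c (new-reach r)) } }
    where open _≅_ I

  update-cong : ∀ {G G′} (I : G ≅ G′) dec dec′ {c d} → Reachable G c → Reachable G d →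
    updateP G dec c d ≅ updateP G′ dec′ (_≅_.to I c) (_≅_.to I d)
  update-cong {G} {G′} I dec dec′ {c} {d} rc rd = record
    { to = to ; from = from ; to-label = to-label
    ; to-succ = updated-succ
    ; from-to = λ e r → from-to e (update-reach dec rd r)
    ; to-from = λ e r → to-from e (update-reach dec′ (to-reach I rd) r) }
    where
      open _≅_ I
      updated-succ : ∀ e → Reachable (updateP G dec c d) e →
        (if does (dec′ (to e) (to c)) then just (to d) else succ G′ (to e))
          ≡ Maybe.map to (if does (dec e c) then just d else succ G e)
      updated-succ e r with dec e c | dec′ (to e) (to c)
      ... | yes _    | yes _  = refl
      ... | yes refl | no ne  = ⊥-elim (ne refl)
      ... | no ne    | yes eq = ⊥-elim (ne (to-injective I (update-reach dec rd r) rc eq))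
      ... | no _     | no _   = to-succ e (update-reach dec rd r)

  update-≡ : ∀ {G : Pointed np} dec {c d c′ d′} → c ≡ c′ → d ≡ d′ →
    updateP G dec c d ≅ updateP G dec c′ d′
  update-≡ dec refl refl = ≅-refl

  relabel-L : ∀ (H : Heap np) x t p → L (relabel H x t) p ≡ retarget x t (L H) p
  relabel-L H x t null = refl
  relabel-L H x t (var y) with x ≟ y
  ... | yes _ = refl
  ... | no _  = refl

  unfold-relabel : ∀ (H : Heap np) x t → unfold (relabel H x t) ≅ relabelP (unfold H) x (t , 0)
  unfold-relabel H x t =
    ≅-same (λ p → trans (cong (_, 0) (relabel-L H x t p)) (retarget-map (_, 0) x t (L H) p)) (λ _ _ → refl)

  new-L : ∀ (H : Heap np) x p → L (newHeap H x) p ≡ retarget x zero (λ p → suc (L H p)) p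
  new-L H x null = refl
  new-L H x (var y) with x ≟ y
  ... | yes _ = refl
  ... | no _  = refl

  unfold-new : ∀ (H : Heap np) x → unfold (newHeap H x) ≅ newP (unfold H) x
  unfold-new H x = record
    { to = old ; from = back
    ; to-label = λ p → trans (cong (λ a → old (a , 0)) (new-L H x p))
                             (retarget-map (λ a → old (a , 0)) x zero (λ p → suc (L H p)) p)
    ; to-succ = old-succ ; from-to = back-old ; to-from = λ { nothing _ → refl ; (just _) _ → refl } }
    where
      old : Fin (suc (V H)) × ℕ → Maybe (Fin (V H) × ℕ)
      old (zero , _)  = nothing
      old (suc a , k) = just (a , k)
      back : Maybe (Fin (V H) × ℕ) → Fin (suc (V H)) × ℕ
      back nothing        = zero , 0
      back (just (a , k)) = suc a , k
      -- the edge out of the new cell has weight 1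
      new-offset : ∀ {k} → Reachable (unfold (newHeap H x)) (zero , k) → k ≡ 0
      new-offset r = n<1⇒n≡0 (reachable-offset (newHeap H x) r)
      old-succ : ∀ c → Reachable (unfold (newHeap H x)) c →
        succ (newP (unfold H) x) (old c) ≡ Maybe.map old (succ (unfold (newHeap H x)) c)
      old-succ (zero , k) r = refl
      old-succ (suc a , k) r = begin
        Maybe.map just (stepOn a k (next H a))
          ≡⟨ map-∘ (stepOn a k (next H a)) ⟩
        Maybe.map old (Maybe.map (map₁ suc) (stepOn a k (next H a)))
          ≡⟨ cong (Maybe.map old) (stepOn-rename suc a k (next H a)) ⟨
        Maybe.map old (stepOn (suc a) k (Maybe.map (map₁ suc) (next H a)))
          ∎
        where open ≡-Reasoning
      back-old : ∀ c → Reachable (unfold (newHeap H x)) c → back (old c) ≡ c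
      back-old (zero , k) r = cong (zero ,_) (sym (new-offset r))
      back-old (suc a , k) _ = refl

  _≟ₚ_ : ∀ {n} → DecidableEquality (Fin n × ℕ)
  _≟ₚ_ = ≡-dec _≟_ _≟ℕ_

  update-next : ∀ (H : Heap np) x y ne v →
    next (updateHeap H x y ne) v ≡ (if does (v ≟ L H (var x)) then just (L H y , 1) else next H v)
  update-next H x y ne v with v ≟ L H (var x)
  ... | yes _ = refl
  ... | no _  = refl

  -- the updated edge has weight 1, so only offset 0 is reachable on it
  unfold-update : ∀ (H : Heap np) x y ne →
    unfold (updateHeap H x y ne) ≅ updateP (unfold H) _≟ₚ_ (L H (var x) , 0) (L H y , 0)
  unfold-update H x y ne = ≅-same (λ _ → refl) λ { (a , k) r → updated-succ a k r (a ≟ L H (var x)) }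
    where
      U = updateHeap H x y ne
      next-x : ∀ {a} → a ≡ L H (var x) → next U a ≡ just (L H y , 1)
      next-x {a} a≡x = trans (update-next H x y ne a) (if-yes (a ≟ _) a≡x)
      updated-succ : ∀ a k → Reachable (unfold U) (a , k) → Dec (a ≡ L H (var x)) →
        (if does ((a , k) ≟ₚ (L H (var x) , 0)) then just (L H y , 0) else stepOn a k (next H a))
          ≡ stepOn a k (next U a)
      updated-succ a k _ (no a≢x) =
        trans (if-no ((a , k) ≟ₚ _) (a≢x ∘ cong proj₁))
              (cong (stepOn a k) (sym (trans (update-next H x y ne a) (if-no (a ≟ _) a≢x))))
      updated-succ a k r (yes a≡x)
        rewrite n<1⇒n≡0 (subst (λ m → k < span m) (next-x a≡x) (reachable-offset U r)) =
        trans (if-yes ((a , 0) ≟ₚ _) (cong (_, 0) a≡x)) (cong (stepOn a 0) (sym (next-x a≡x)))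

  lookup-unfold : ∀ {H : Heap np} {x y R} → Lookup H x y R →
    Σ (Fin (V H) × ℕ) λ s → succ (unfold H) (L H y , 0) ≡ just s × unfold R ≅ relabelP (unfold H) x s
  lookup-unfold {H} {x} {y} (inj₁ (t , e , refl)) =
    (t , 0) , step-across H e (λ { (s≤s ()) }) , unfold-relabel H x t
  lookup-unfold {H} {x} {y} (inj₂ (S , s , refl , refl , refl)) =
    (u , 1) , step-one , ≅-trans (unfold-relabel S x q) (≅-sym moved)
    where
      open Subdiv1 s
      step-one : succ (unfold H) (u , 0) ≡ just (u , 1)
      step-one = step-inside H edge (s≤s (Subdivided.w₂-pos s))
      -- the position one unit after u is split to the fresh vertex q
      moved : relabelP (unfold H) x (u , 1) ≅ relabelP (unfold S) x (q , 0)
      moved = ≅-trans (relabel-cong (Subdivided.subdiv-≅ s) x (step (root y) step-one))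
                      (relabel-≡ (Subdivided.split-new s (λ { (s≤s ()) })))

  lookup-exists : ∀ (B : Heap np) x y {s} → succ (unfold B) (L B y , 0) ≡ just s →
    Σ (Heap np) λ R → Lookup B x y R
  lookup-exists B x y {s} e = by-edge (next B (L B y)) refl
    where
      by-edge : ∀ m → next B (L B y) ≡ m → Σ (Heap np) λ R → Lookup B x y R
      by-edge nothing ey = ⊥-elim (nothing≢just (trans (sym (step-stuck B {k = 0} ey)) e))
      by-edge (just (t , zero)) ey with weight-pos B _ t 0 ey
      ... | ()
      by-edge (just (t , suc zero)) ey = relabel B x t , inj₁ (t , ey , refl)
      by-edge (just (t , suc (suc m))) ey =
        _ , inj₂ (SplitFirstUnit.H′ B (L B y) t m ey , SplitFirstUnit.subdiv B (L B y) t m ey , refl , refl , refl)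

  Respects : (Heap np → Heap np → Set) → Set
  Respects T = ∀ {B B′ : Heap np} → unfold B ≅ unfold B′ → ∀ {R} → T B R →
    Σ (Heap np) λ R′ → T B′ R′ × unfold R ≅ unfold R′

  assign-respects : ∀ x y → Respects (λ H R → Assign H x y R)
  assign-respects x y {B} {B′} I refl = relabel B′ x (L B′ y) , refl ,
    ≅-trans (unfold-relabel B x (L B y))
      (≅-trans (relabel-cong I x (root y))
        (≅-trans (relabel-≡ (_≅_.to-label I y)) (≅-sym (unfold-relabel B′ x (L B′ y)))))

  new-respects : ∀ x → Respects (λ H R → New H x R)
  new-respects x {B} {B′} I refl = newHeap B′ x , refl ,
    ≅-trans (unfold-new B x) (≅-trans (new-cong I x) (≅-sym (unfold-new B′ x)))

  update-respects : ∀ x y → Respects (λ H R → Update H x y R)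
  update-respects x y {B} {B′} I (ne , refl) = updateHeap B′ x y ne′ , (ne′ , refl) ,
    ≅-trans (unfold-update B x y ne)
      (≅-trans (update-cong I _≟ₚ_ _≟ₚ_ (root (var x)) (root y))
        (≅-trans (update-≡ _≟ₚ_ (_≅_.to-label I (var x)) (_≅_.to-label I y))
          (≅-sym (unfold-update B′ x y ne′))))
    where
      ne′ : L B′ (var x) ≢ L B′ null
      ne′ = ne ∘ alias-≅ {H₁ = B′} {H₂ = B} (≅-sym I) (var x) null

  lookup-respects : ∀ x y → Respects (λ H R → Lookup H x y R)
  lookup-respects x y {B} {B′} I look with lookup-unfold look
  ... | s , step-y , R≅ with lookup-exists B′ x y (label-step I y step-y)
  ... | R′ , look′ with lookup-unfold look′
  ... | s′ , step-y′ , R′≅ = R′ , look′ ,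
    ≅-trans R≅ (≅-trans (relabel-cong I x (step (root y) step-y))
      (≅-trans (relabel-≡ (just-injective (trans (sym (label-step I y step-y)) step-y′))) (≅-sym R′≅)))

module Invariance {D : Set} (emb : ℕ∞ → D) {np nh nd : ℕ} where

  record Similar (Γ₁ Γ₂ : Interp D np nh nd) : Set where
    field
      heaps       : ∀ h → unfold (heap Γ₁ h) ≅ unfold (heap Γ₂ h)
      data-values : ∀ i → dval Γ₁ i ≡ dval Γ₂ i
  open Similar

  similar-sym : ∀ {Γ₁ Γ₂} → Similar Γ₁ Γ₂ → Similar Γ₂ Γ₁
  similar-sym sim = record { heaps = ≅-sym ∘ heaps sim ; data-values = sym ∘ data-values sim }

  module _ {Γ₁ Γ₂ : Interp D np nh nd} (sim : Similar Γ₁ Γ₂) where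

    eval-similar : ∀ t d → EvalT emb Γ₁ t d → EvalT emb Γ₂ t d
    eval-similar (dvar i)           d ev = trans ev (data-values sim i)
    eval-similar (const c)          d ev = ev
    eval-similar (app f t₁ t₂)      d (d₁ , d₂ , ev₁ , ev₂ , eq) =
      d₁ , d₂ , eval-similar t₁ d₁ ev₁ , eval-similar t₂ d₂ ev₂ , eq
    eval-similar (pathLength h x y) d (n , len , eq) =
      n , pathLen-≅ {H₁ = heap Γ₁ h} {H₂ = heap Γ₂ h} (heaps sim h) x y n len , eq

    -- h′ = T(h) is preserved: transport the result along the isomorphism
    -- at h, and the homeomorphism along the one at h′ (homeomorphism is
    -- isomorphism of unfoldings)
    trans-similar : ∀ T → Respects T → ∀ h′ h → Trans emb Γ₁ T h′ h → Trans emb Γ₂ T h′ h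
    trans-similar T respects h′ h (R , result , homeo) with respects (heaps sim h) result
    ... | R′ , result′ , R≅R′ =
      R′ , result′ , ≅→homeo (≅-trans (≅-sym (heaps sim h′)) (≅-trans (homeo→≅ homeo) R≅R′))

  -- the main invariance: by induction on φ (negation uses symmetry)
  holds-similar : ∀ (φ : Formula D np nh nd) {Γ₁ Γ₂} → Similar Γ₁ Γ₂ → ⟦_⟧ emb Γ₁ φ → ⟦_⟧ emb Γ₂ φ
  holds-similar (rel R t₁ t₂) sim (d₁ , d₂ , ev₁ , ev₂ , r) =
    d₁ , d₂ , eval-similar sim t₁ d₁ ev₁ , eval-similar sim t₂ d₂ ev₂ , r
  holds-similar (alias h x y)  {Γ₁} {Γ₂} sim = alias-≅ {H₁ = heap Γ₁ h} {H₂ = heap Γ₂ h} (heaps sim h) x y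
  holds-similar (isPath h x y) {Γ₁} {Γ₂} sim = hasPath-≅ {H₁ = heap Γ₁ h} {H₂ = heap Γ₂ h} (heaps sim h) x y
  holds-similar (isNull h x)   {Γ₁} {Γ₂} sim = alias-≅ {H₁ = heap Γ₁ h} {H₂ = heap Γ₂ h} (heaps sim h) x null
  holds-similar (circular h x) {Γ₁} {Γ₂} sim = cyclic-≅ {H₁ = heap Γ₁ h} {H₂ = heap Γ₂ h} (heaps sim h) x
  holds-similar (new h′ h x)      sim = trans-similar sim (λ H R → New H x R) (new-respects x) h′ h
  holds-similar (assign h′ h x y) sim = trans-similar sim (λ H R → Assign H x y R) (assign-respects x y) h′ h
  holds-similar (lookup h′ h x y) sim = trans-similar sim (λ H R → Lookup H x y R) (lookup-respects x y) h′ h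
  holds-similar (update h′ h x y) sim = trans-similar sim (λ H R → Update H x y R) (update-respects x y) h′ h
  holds-similar ⊤'                sim = λ t → t
  holds-similar (¬' φ)            sim = λ ¬φ φ₂ → ¬φ (holds-similar φ (similar-sym sim) φ₂)
  holds-similar (φ ∧' ψ)          sim = λ { (a , b) → holds-similar φ sim a , holds-similar ψ sim b }
  holds-similar (φ ∨' ψ)          sim = λ { (inj₁ a) → inj₁ (holds-similar φ sim a)
                                          ; (inj₂ b) → inj₂ (holds-similar ψ sim b) }

-- Fin m viewed as Fin N with the vertex v removed.
record Punctured (N m : ℕ) (v : Fin N) : Set where
  field
    ι     : Fin m → Fin N
    ι-inj : ∀ a b → ι a ≡ ι b → a ≡ b
    ι≢v   : ∀ a → ι a ≢ v
    ρ     : ∀ b → b ≢ v → Fin m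
    ι∘ρ   : ∀ b b≢v → ι (ρ b b≢v) ≡ b

  ρ∘ι : ∀ a a≢v → ρ (ι a) a≢v ≡ a
  ρ∘ι a a≢v = ι-inj _ _ (ι∘ρ (ι a) a≢v)

  ρ-cong : ∀ {b b′} b≢v b′≢v → b ≡ b′ → ρ b b≢v ≡ ρ b′ b′≢v
  ρ-cong {b} b≢v b′≢v refl = ι-inj _ _ (trans (ι∘ρ b b≢v) (sym (ι∘ρ b b′≢v)))

puncture : ∀ {N m} → N ≡ suc m → (v : Fin N) → Punctured N m v
puncture refl v = record
  { ι = punchIn v ; ι-inj = punchIn-injective v ; ι≢v = punchInᵢ≢i v
  ; ρ = λ b b≢v → punchOut (b≢v ∘ sym) ; ι∘ρ = λ b b≢v → punchIn-punchOut (b≢v ∘ sym) }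

module _ {np : ℕ} where

  module Delete (H : Heap np) {m} (size : V H ≡ suc m) (v : Fin (V H)) (null≢v : L H null ≢ v) where
    open Punctured (puncture size v)

    -- collapse v onto the null vertex
    shrink : Fin (V H) → Fin m
    shrink b with b ≟ v
    ... | yes _  = ρ (L H null) null≢v
    ... | no b≢v = ρ b b≢v

    ι∘shrink : ∀ b → b ≢ v → ι (shrink b) ≡ b
    ι∘shrink b b≢v with b ≟ v
    ... | yes b≡v = ⊥-elim (b≢v b≡v)
    ... | no b≢v′ = ι∘ρ b b≢v′

    shrink∘ι : ∀ a → shrink (ι a) ≡ a
    shrink∘ι a = ι-inj _ _ (ι∘shrink (ι a) (ι≢v a))

    next′ : Fin m → Maybe (Fin m × ℕ)
    next′ a = Maybe.map (map₁ shrink) (next H (ι a))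

    H′ : Heap np
    H′ = record
      { V = m ; next = next′ ; L = shrink ∘ L H
      ; weight-pos = weight-pos′ ; sink-null = sink-null′ ; null-sink = null-sink′ }
      where
        weight-pos′ : ∀ a t w → next′ a ≡ just (t , w) → 1 ≤ w
        weight-pos′ a t w e with next H (ι a) in ea
        weight-pos′ a t w refl | just (t′ , w′) = weight-pos H (ι a) t′ w′ ea
        sink-null′ : ∀ a → next′ a ≡ nothing → a ≡ shrink (L H null)
        sink-null′ a e with next H (ι a) in ea
        ... | nothing = trans (sym (shrink∘ι a)) (cong shrink (sink-null H (ι a) ea))
        null-sink′ : next′ (shrink (L H null)) ≡ nothing
        null-sink′ = cong (Maybe.map (map₁ shrink))
                          (trans (cong (next H) (ι∘shrink (L H null) null≢v)) (null-sink H))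

    delete-≅ : ¬ Reach H v → unfold H ≅ unfold H′
    delete-≅ unreachable = record
      { to = map₁ shrink ; from = map₁ ι
      ; to-label = λ _ → refl
      ; to-succ = λ { (b , k) r → trans
          (cong (λ c → stepOn (shrink b) k (Maybe.map (map₁ shrink) (next H c))) (ι∘shrink b (off-v r)))
          (stepOn-rename shrink b k (next H b)) }
      ; from-to = λ { (b , k) r → cong (_, k) (ι∘shrink b (off-v r)) }
      ; to-from = λ { (a , k) _ → cong (_, k) (shrink∘ι a) } }
      where
        off-v : ∀ {b k} → Reachable (unfold H) (b , k) → b ≢ v
        off-v r refl = unreachable (reachable→reach H r)

  -- Smoothing away an unlabelled vertex q whose only incoming edge is
  -- u → q: the result is a heap of which H is a one-edge subdivision.
  module Smooth (H : Heap np) {m} (size : V H ≡ suc m) (q : Fin (V H)) (unlabelled : Unlabelled H q)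
                (u : Fin (V H)) (w : ℕ) (eu : next H u ≡ just (q , w))
                (unique : ∀ u′ w′ → next H u′ ≡ just (q , w′) → u′ ≡ u) (u≢q : u ≢ q) where
    open Punctured (puncture size q)

    -- q is not the sink (it is unlabelled), so it has an edge q → t
    out-q : Σ (Fin (V H)) λ t → Σ ℕ λ w₂ → next H q ≡ just (t , w₂)
    out-q with next H q in eq
    ... | just (t , w₂) = t , w₂ , refl
    ... | nothing       = ⊥-elim (unlabelled null (sym (sink-null H q eq)))

    t = proj₁ out-q
    w₂ = proj₁ (proj₂ out-q)
    eq : next H q ≡ just (t , w₂)
    eq = proj₂ (proj₂ out-q)

    t≢q : t ≢ q
    t≢q t≡q = u≢q (sym (unique q w₂ (trans eq (cong (λ z → just (z , w₂)) t≡q))))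

    bypass : Maybe (Fin (V H) × ℕ) → Maybe (Fin m × ℕ)
    bypass nothing = nothing
    bypass (just (b , w′)) with b ≟ q
    ... | yes _  = just (ρ t t≢q , w′ + w₂)
    ... | no b≢q = just (ρ b b≢q , w′)

    bypass-q : ∀ w′ → bypass (just (q , w′)) ≡ just (ρ t t≢q , w′ + w₂)
    bypass-q w′ with q ≟ q
    ... | yes _  = refl
    ... | no q≢q = ⊥-elim (q≢q refl)

    bypass-other : ∀ e → (∀ w′ → e ≢ just (q , w′)) → Maybe.map (map₁ ι) (bypass e) ≡ e
    bypass-other nothing _ = refl
    bypass-other (just (b , w′)) not-q with b ≟ q
    ... | yes refl = ⊥-elim (not-q w′ refl)
    ... | no b≢q   = cong (λ z → just (z , w′)) (ι∘ρ b b≢q)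

    next′ : Fin m → Maybe (Fin m × ℕ)
    next′ a = bypass (next H (ι a))

    L′ : Ptr np → Fin m
    L′ p = ρ (L H p) (unlabelled p)

    H′ : Heap np
    H′ = record
      { V = m ; next = next′ ; L = L′
      ; weight-pos = weight-pos′ ; sink-null = sink-null′ ; null-sink = null-sink′ }
      where
        weight-pos′ : ∀ a t w → next′ a ≡ just (t , w) → 1 ≤ w
        weight-pos′ a _ _ e with next H (ι a) in ea
        ... | just (b , w′) with b ≟ q
        weight-pos′ a _ _ refl | just (b , w′) | yes _ = ≤-trans (weight-pos H (ι a) b w′ ea) (m≤m+n w′ w₂)
        weight-pos′ a _ _ refl | just (b , w′) | no _  = weight-pos H (ι a) b w′ ea
        sink-null′ : ∀ a → next′ a ≡ nothing → a ≡ L′ null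
        sink-null′ a e with next H (ι a) in ea
        ... | nothing = trans (sym (ρ∘ι a (ι≢v a))) (ρ-cong _ _ (sink-null H (ι a) ea))
        ... | just (b , w′) with b ≟ q
        sink-null′ a () | just _ | yes _
        sink-null′ a () | just _ | no _
        null-sink′ : next′ (L′ null) ≡ nothing
        null-sink′ = cong bypass (trans (cong (next H) (ι∘ρ (L H null) (unlabelled null))) (null-sink H))

    cover : ∀ b → b ≡ q ⊎ Σ (Fin m) λ a → ι a ≡ b
    cover b with b ≟ q
    ... | yes b≡q = inj₁ b≡q
    ... | no b≢q  = inj₂ (ρ b b≢q , ι∘ρ b b≢q)

    subdiv : Subdiv1 H′ H
    subdiv = record
      { ι = ι ; ι-inj = ι-inj ; q = q ; fresh = ι≢v
      ; cover = cover
      ; u = ρ u u≢q ; v = ρ t t≢q ; w₁ = w ; w₂ = w₂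
      ; edge = trans (cong bypass (trans (cong (next H) (ι∘ρ u u≢q)) eu)) (bypass-q w)
      ; edge-u = trans (cong (next H) (ι∘ρ u u≢q)) eu
      ; edge-q = trans eq (cong (λ z → just (z , w₂)) (sym (ι∘ρ t t≢q)))
      ; other = λ a a≢u → sym (bypass-other (next H (ι a))
                  (λ w′ e → a≢u (trans (sym (ρ∘ι a (ι≢v a))) (ρ-cong _ _ (unique (ι a) w′ e)))))
      ; lab = λ p → sym (ι∘ρ (L H p) (unlabelled p)) }

after : ∀ {N} → Fin N → Maybe (Fin N × ℕ) → Fin N
after a nothing        = a
after a (just (t , _)) = t

module _ {np : ℕ} (H : Heap np) where

  chain : Fin (V H) → ℕ → Fin (V H)
  chain a zero    = a
  chain a (suc j) = chain (after a (next H a)) j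

  chain-+ : ∀ i r a → chain a (i + r) ≡ chain (chain a i) r
  chain-+ zero    r a = refl
  chain-+ (suc i) r a = chain-+ i r _

  walk→chain : ∀ {u v k} → Walk H u v k → Σ ℕ λ j → chain u j ≡ v
  walk→chain [] = 0 , refl
  walk→chain {u} (e ∷ walk) with walk→chain walk
  ... | j , reached = suc j , trans (cong (λ n → chain (after u n) j) e) reached

  chain→path : ∀ j {u v} → chain u j ≡ v → HasPath H u v
  chain→path zero    refl = 0 , []
  chain→path (suc j) {u} reached with next H u in eu
  ... | nothing = chain→path j reached
  ... | just (t , w) with chain→path j reached
  ...   | k , walk = w + k , (eu ∷ walk)

  -- Whatever the chain from u reaches, it reaches within V H steps:
  -- otherwise some vertex repeats (pigeonhole) and the loop can be cut.
  chain-short : ∀ fuel j {u v} → j ≤ fuel → chain u j ≡ v → Σ (Fin (suc (V H))) λ i → chain u (toℕ i) ≡ v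
  chain-short fuel j {u} j≤fuel reached with j <? suc (V H)
  ... | yes j<V+1 = fromℕ< j<V+1 , trans (cong (chain u) (toℕ-fromℕ< j<V+1)) reached
  chain-short zero j j≤0 _ | no j≮V+1 = ⊥-elim (j≮V+1 (≤-<-trans j≤0 z<s))
  chain-short (suc fuel) j {u} {v} j≤fuel reached | no j≮V+1
    with pigeonhole (n<1+n (V H)) (λ i → chain u (toℕ i))
  ... | i , i′ , i<i′ , repeat
    with m≤n⇒∃[o]m+o≡n (≤-trans (s≤s⁻¹ (toℕ<n i′)) (≤-trans (n≤1+n (V H)) (≮⇒≥ j≮V+1)))
  ...   | r , i′+r≡j = chain-short fuel (toℕ i + r) shorter (begin
    chain u (toℕ i + r)       ≡⟨ chain-+ (toℕ i) r u ⟩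
    chain (chain u (toℕ i)) r  ≡⟨ cong (λ a → chain a r) repeat ⟩
    chain (chain u (toℕ i′)) r ≡⟨ chain-+ (toℕ i′) r u ⟨
    chain u (toℕ i′ + r)      ≡⟨ cong (chain u) i′+r≡j ⟩
    chain u j                 ≡⟨ reached ⟩
    v                         ∎)
    where
      open ≡-Reasoning
      shorter : toℕ i + r ≤ fuel
      shorter = s≤s⁻¹ (<-≤-trans (subst (toℕ i + r <_) i′+r≡j (+-monoˡ-< r i<i′)) j≤fuel)

  reach-within? : ∀ p v → Dec (Σ (Fin (suc (V H))) λ i → chain (L H p) (toℕ i) ≡ v)
  reach-within? p v = any? (λ i → chain (L H p) (toℕ i) ≟ v)

  reach? : ∀ v → Dec (Reach H v)
  reach? v with reach-within? null v | any? (λ y → reach-within? (var y) v)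
  ... | yes (i , reached) | _ = yes (null , chain→path (toℕ i) reached)
  ... | no _ | yes (y , i , reached) = yes (var y , chain→path (toℕ i) reached)
  ... | no ¬null | no ¬var = no λ { (p , _ , walk) → unreached p (walk→chain walk) }
    where
      unreached : ∀ p → ¬ (Σ ℕ λ j → chain (L H p) j ≡ v)
      unreached null    (j , reached) = ¬null (chain-short j j ≤-refl reached)
      unreached (var y) (j , reached) = ¬var (y , chain-short j j ≤-refl reached)

  all-reachable : ¬ (Σ (Fin (V H)) λ v → ¬ Reach H v) → ∀ v → Reach H v
  all-reachable none-unreachable v = decidable-stable (reach? v) (λ ¬r → none-unreachable (v , ¬r))

  EdgeTo : Fin (V H) → Fin (V H) → Set
  EdgeTo u q = Σ ℕ λ w → next H u ≡ just (q , w)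

  edgeTo? : ∀ u q → Dec (EdgeTo u q)
  edgeTo? u q with next H u
  ... | nothing = no λ ()
  ... | just (t , w) with t ≟ q
  ...   | yes refl = yes (w , refl)
  ...   | no t≢q   = no λ { (_ , e) → t≢q (cong proj₁ (just-injective e)) }

  single-incoming? : ∀ q → Dec (SingleIncoming H q)
  single-incoming? q with any? (λ u → edgeTo? u q ×-dec all? (λ u′ → edgeTo? u′ q →-dec (u′ ≟ u)))
  ... | yes (u , (w , e) , only-u) = yes (u , w , e , λ u′ w′ e′ → only-u u′ (w′ , e′))
  ... | no none = no λ { (u , w , e , only-u) → none (u , (w , e) , λ u′ (w′ , e′) → only-u u′ w′ e′) }

  unlabelled? : ∀ q → Dec (Unlabelled H q)
  unlabelled? q with ¬? (L H null ≟ q) | all? (λ y → ¬? (L H (var y) ≟ q))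
  ... | yes ¬null | yes ¬var = yes λ { null → ¬null ; (var y) → ¬var y }
  ... | no null-at-q | _          = no λ unl → null-at-q (unl null)
  ... | _           | no var-at-q = no λ unl → var-at-q (unl ∘ var)

  smoothable? : ∀ q → Dec (Smoothable H q)
  smoothable? q = unlabelled? q ×-dec single-incoming? q

  entry-edge : ∀ {a b k} → Walk H a b k → a ≢ b → Σ (Fin (V H)) λ c → c ≢ b × EdgeTo c b
  entry-edge [] a≢b = ⊥-elim (a≢b refl)
  entry-edge {a} {b} (_∷_ {v = t} {w = w} e walk) a≢b with t ≟ b
  ... | yes refl = a , a≢b , w , e
  ... | no t≢b   = entry-edge walk t≢b

  predecessor-distinct : (∀ v → Reach H v) → ∀ {q u} → Unlabelled H q →
    (∀ u′ w′ → next H u′ ≡ just (q , w′) → u′ ≡ u) → u ≢ q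
  predecessor-distinct all-reach {q} unl unique u≡q with all-reach q
  ... | p , _ , walk with entry-edge walk (unl p)
  ...   | c , c≢q , w′ , ec = c≢q (trans (unique c w′ ec) u≡q)

module _ {np : ℕ} where

  Reduces : Heap np → ℕ → Set
  Reduces H m = Σ (Heap np) λ H′ → V H′ ≡ m × unfold H ≅ unfold H′

  delete-step : ∀ (H : Heap np) {m} → V H ≡ suc m → ∀ {v} → ¬ Reach H v → Reduces H m
  delete-step H size {v} unreachable =
    Delete.H′ H size v null≢v , refl , Delete.delete-≅ H size v null≢v unreachable
    where
      null≢v : L H null ≢ v
      null≢v refl = unreachable (null , 0 , [])

  smooth-step : ∀ (H : Heap np) {m} → V H ≡ suc m → (∀ v → Reach H v) →
    ∀ {q} → Smoothable H q → Reduces H m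
  smooth-step H size all-reach {q} (unl , u , w , eu , unique) =
    Smooth.H′ H size q unl u w eu unique u≢q , refl ,
    ≅-sym (Subdivided.subdiv-≅ (Smooth.subdiv H size q unl u w eu unique u≢q))
    where
      u≢q : u ≢ q
      u≢q = predecessor-distinct H all-reach unl unique

  -- Every heap has a kernel with isomorphic unfolding: delete unreachable
  -- vertices and smooth away smoothable ones (induction on the size;
  -- a heap has at least the null vertex).
  kernel′ : ∀ n (H : Heap np) → V H ≡ n → Σ (Heap np) λ K → IsKernel K × unfold H ≅ unfold K
  kernel-via : ∀ m (H : Heap np) → Reduces H m → Σ (Heap np) λ K → IsKernel K × unfold H ≅ unfold K

  kernel′ zero    H size = ⊥-elim (¬Fin0 (subst Fin size (L H null)))
  kernel′ (suc m) H size with any? (λ v → ¬? (reach? H v))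
  ... | yes (v , unreachable) = kernel-via m H (delete-step H size unreachable)
  ... | no none-unreachable with any? (smoothable? H)
  ...   | yes (q , smooth) = kernel-via m H (smooth-step H size (all-reachable H none-unreachable) smooth)
  ...   | no none-smoothable =
    H , (all-reachable H none-unreachable , λ q s → none-smoothable (q , s)) , ≅-refl

  kernel-via m H (H′ , size′ , I) with kernel′ m H′ size′
  ... | K , is-kernel , J = K , is-kernel , ≅-trans I J

  kernel : (H : Heap np) → Σ (Heap np) λ K → IsKernel K × unfold H ≅ unfold K
  kernel H = kernel′ (V H) H refl

theorem3 : {D : Set} (emb : ℕ∞ → D) {np nh nd : ℕ}
    (φ : Formula D np nh nd) (Γ : Interp D np nh nd) →
    ¬ ⟦_⟧ emb Γ φ →
    Σ (Interp D np nh nd) λ Γ' →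
      ¬ ⟦_⟧ emb Γ' φ × ((h : Fin nh) → IsKernel (heap Γ' h))
theorem3 emb φ Γ ¬φ = Γ′ , (¬φ ∘ holds-similar φ Γ′∼Γ) , (λ h → proj₁ (proj₂ (kernel (heap Γ h))))
  where
    open Invariance emb
    Γ′ = record { heap = λ h → proj₁ (kernel (heap Γ h)) ; dval = dval Γ }
    Γ′∼Γ : Similar Γ′ Γ
    Γ′∼Γ = record { heaps = λ h → ≅-sym (proj₂ (proj₂ (kernel (heap Γ h)))) ; data-values = λ _ → refl }
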